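{- Let $m,m'\in\mathbb{Z}^d$ be not collinear, let $\mathcal{F}\subset\mathbb{Z}^d$ be a finite set, and let $\pi$ be the uniform distribution on $\mathcal{F}$. The matrices $\mathcal{H}^{\pi}_{\mathcal{F},m}$ and $\mathcal{H}^{\pi}_{\mathcal{F},m'}$ commute if and only if $(m,m')$ has the intersecting ray property in $\mathcal{F}$.
   Context: Ray $\mathcal{R}_{\mathcal{F}}(u,m):=(u+\mathbb{Z}m)\cap\mathcal{F}$ for $u\in\mathcal{F}$; a ray parallel to $m$ is a set of this form. $\mathcal{H}^{\pi}_{\mathcal{F},m}$ is the $\mathcal{F}\times\mathcal{F}$ matrix with $(x,y)$-entry $\pi(y)/\pi(\mathcal{R}_{\mathcal{F}}(x,m))$ if $y\in\mathcal{R}_{\mathcal{F}}(x,m)$ and $0$ otherwise, $\pi(S)=\sum_{y\in S}\pi(y)$. For non-collinear $m,m'$, the pair $(m,m')$ has the intersecting ray property in $\mathcal{F}$ if: for any rays $\mathcal{R}_1,\mathcal{R}_2$ parallel to $m$ and any rays $\mathcal{R}_1',\mathcal{R}_2'$ parallel to $m'$ such that $\mathcal{R}_1\cap\mathcal{R}_1'\neq\emptyset$ and $\mathcal{R}_2\cap\mathcal{R}_2'\neq\emptyset$, the condition $\mathcal{R}_1\cap\mathcal{R}_2'\neq\emptyset$ implies $\mathcal{R}_1'\cap\mathcal{R}_2\neq\emptyset$ and $|\mathcal{R}_1|\cdot|\mathcal{R}_1'|^{ -1}=|\mathcal{R}_2|\cdot|\mathcal{R}_2'|^{ -1}$. -}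

module Defs where

open import Data.Nat as ℕ using (ℕ)
import Data.Nat.Properties as ℕP
import Data.Nat.DivMod as ℕD
open import Data.Integer as ℤ using (ℤ; +_; +0; +[1+_]; -[1+_]; ∣_∣; sign; _◃_)
import Data.Integer.Properties as ℤP
import Data.Sign as Sign
open import Data.Rational as ℚ using (ℚ; mkℚ)
open import Data.Vec using (Vec; []; _∷_; map; zipWith)
import Data.Vec.Properties as VecP
open import Data.List as List using (List; filter; length; foldr)
open import Data.List.Membership.Propositional using (_∈_)
open import Data.Product using (Σ; ∃; _×_; _,_; proj₁; proj₂)
open import Relation.Nullary using (Dec; yes; no; ¬_)
open import Relation.Nullary.Decidable using (map′)
open import Relation.Binary.PropositionalEquality
open import Data.Empty using (⊥-elim)

_·ᵥ_ : ∀ {d} → ℤ → Vec ℤ d → Vec ℤ d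
k ·ᵥ m = map (k ℤ.*_) m

_-ᵥ_ : ∀ {d} → Vec ℤ d → Vec ℤ d → Vec ℤ d
y -ᵥ x = zipWith ℤ._-_ y x

lin : ∀ {d} → ℤ → Vec ℤ d → ℤ → Vec ℤ d → Vec ℤ d
lin a m b m' = zipWith ℤ._+_ (a ·ᵥ m) (b ·ᵥ m')

zeroᵥ : ∀ {d} → Vec ℤ d
zeroᵥ {ℕ.zero} = []
zeroᵥ {ℕ.suc d} = +0 ∷ zeroᵥ

NotCollinear : ∀ {d} → Vec ℤ d → Vec ℤ d → Set
NotCollinear m m' = ∀ (a b : ℤ) → lin a m b m' ≡ zeroᵥ → (a ≡ +0) × (b ≡ +0)

InLine : ∀ {d} → Vec ℤ d → Vec ℤ d → Vec ℤ d → Set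
InLine u m y = ∃ λ (k : ℤ) → y -ᵥ u ≡ k ·ᵥ m

private
  nz : ∀ {i} → i ≢ +0 → ℕ.NonZero ∣ i ∣
  nz {+[1+ n ]} _ = _
  nz { +0} p = ⊥-elim (p refl)
  nz { -[1+ n ]} _ = _

  quot : (v mi : ℤ) → mi ≢ +0 → ℤ
  quot v mi p = (sign v Sign.* sign mi) ◃ ℕD._/_ ∣ v ∣ ∣ mi ∣ {{nz p}}

  sgn : ∀ s t → s Sign.* t Sign.* t ≡ s
  sgn Sign.+ Sign.+ = refl
  sgn Sign.+ Sign.- = refl
  sgn Sign.- Sign.+ = refl
  sgn Sign.- Sign.- = refl

  quot-lemma : ∀ k mi (p : mi ≢ +0) → quot (k ℤ.* mi) mi p ≡ k
  quot-lemma +0 mi p rewrite ℤP.*-zeroˡ mi | ℕD.0/n≡0 ∣ mi ∣ {{nz p}} = refl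
  quot-lemma k@(+[1+ n ]) mi p =
    cong₂ _◃_ (trans (cong (λ s → s Sign.* sign mi) (ℤP.sign-* k mi {{nzkm}})) (sgn (sign k) (sign mi)))
              (trans (cong (λ z → ℕD._/_ z ∣ mi ∣ {{nz p}}) (ℤP.abs-* k mi)) (ℕD.m*n/n≡m ∣ k ∣ ∣ mi ∣ {{nz p}}))
    where nzkm = ℤP.i*j≢0 k mi {{_}} {{nz p}}
  quot-lemma k@(-[1+ n ]) mi p =
    trans (cong₂ _◃_ (trans (cong (λ s → s Sign.* sign mi) (ℤP.sign-* k mi {{nzkm}})) (sgn (sign k) (sign mi)))
              (trans (cong (λ z → ℕD._/_ z ∣ mi ∣ {{nz p}}) (ℤP.abs-* k mi)) (ℕD.m*n/n≡m ∣ k ∣ ∣ mi ∣ {{nz p}})))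
          (ℤP.◃-inverse k)
    where nzkm = ℤP.i*j≢0 k mi {{_}} {{nz p}}

  cand : ∀ {d} → Vec ℤ d → Vec ℤ d → ℤ
  cand [] [] = +0
  cand (v ∷ vs) (mi ∷ ms) with mi ℤP.≟ +0
  ... | yes _ = cand vs ms
  ... | no p = quot v mi p

  cand-ok : ∀ {d} k (v m : Vec ℤ d) → v ≡ k ·ᵥ m → v ≡ cand v m ·ᵥ m
  cand-ok k [] [] eq = refl
  cand-ok k (v ∷ vs) (mi ∷ ms) eq with VecP.∷-injective eq | mi ℤP.≟ +0
  ... | e₁ , e₂ | yes refl =
        cong₂ _∷_ (trans e₁ (trans (ℤP.*-zeroʳ k) (sym (ℤP.*-zeroʳ (cand vs ms))))) (cand-ok k vs ms e₂)
  ... | e₁ , e₂ | no p rewrite e₁ | quot-lemma k mi p = cong (_ ∷_) e₂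

inLine? : ∀ {d} (u m y : Vec ℤ d) → Dec (InLine u m y)
inLine? u m y = map′ (λ e → cand (y -ᵥ u) m , e) (λ (k , e) → cand-ok k _ m e)
                     (VecP.≡-dec ℤP._≟_ (y -ᵥ u) (cand (y -ᵥ u) m ·ᵥ m))

-- Finite sets F ⊂ ℤ^d are duplicate-free lists; rays R_F(u,m) = (u + ℤm) ∩ F

InRay : ∀ {d} → List (Vec ℤ d) → Vec ℤ d → Vec ℤ d → Vec ℤ d → Set
InRay F u m y = (y ∈ F) × InLine u m y

ray : ∀ {d} → List (Vec ℤ d) → Vec ℤ d → Vec ℤ d → List (Vec ℤ d)
ray F u m = filter (inLine? u m) F

∣ray∣ : ∀ {d} → List (Vec ℤ d) → Vec ℤ d → Vec ℤ d → ℕ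
∣ray∣ F u m = length (ray F u m)

-- Matrices indexed by ℤ^d (entries outside F × F are irrelevant)

Matrix : ℕ → Set
Matrix d = Vec ℤ d → Vec ℤ d → ℚ

sumℚ : List ℚ → ℚ
sumℚ = foldr ℚ._+_ ℚ.0ℚ

mass : ∀ {d} → (Vec ℤ d → ℚ) → List (Vec ℤ d) → ℚ
mass π S = sumℚ (List.map π S)

-- total inverse on ℚ (1/q, and 0 for q = 0; only used for q ≠ 0)
inv : ℚ → ℚ
inv q with q ℚ.≟ ℚ.0ℚ
... | yes _ = ℚ.0ℚ
... | no p = ℚ.1/_ q {{ℚ.≢-nonZero p}}
  where import Data.Rational.Properties as ℚP

uniform : ∀ {d} → List (Vec ℤ d) → Vec ℤ d → ℚ
uniform F _ = inv ((+ length F) ℚ./ 1)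

-- H^π_{F,m}: (x,y)-entry π(y)/π(R_F(x,m)) if y ∈ R_F(x,m), else 0
-- (for x, y ∈ F, y ∈ R_F(x,m) iff y ∈ x + ℤm)
H : ∀ {d} → (Vec ℤ d → ℚ) → List (Vec ℤ d) → Vec ℤ d → Matrix d
H π F m x y with inLine? x m y
... | yes _ = π y ℚ.* inv (mass π (ray F x m))
... | no _ = ℚ.0ℚ

mul : ∀ {d} → List (Vec ℤ d) → Matrix d → Matrix d → Matrix d
mul F A B x z = sumℚ (List.map (λ y → A x y ℚ.* B y z) F)

Commute : ∀ {d} → List (Vec ℤ d) → Matrix d → Matrix d → Set
Commute F A B = ∀ x z → x ∈ F → z ∈ F → mul F A B x z ≡ mul F B A x z

Meet : ∀ {d} → List (Vec ℤ d) → Vec ℤ d → Vec ℤ d → Vec ℤ d → Vec ℤ d → Set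
Meet F u m u' m' = ∃ λ y → InRay F u m y × InRay F u' m' y

-- intersecting ray property of (m, m') in F; rays parallel to m are R_F(u,m), u ∈ F.
-- |R₁|·|R₁'|⁻¹ = |R₂|·|R₂'|⁻¹ is written as |R₁|·|R₂'| = |R₂|·|R₁'| (all sizes ≥ 1).
IntersectingRayProperty : ∀ {d} → List (Vec ℤ d) → Vec ℤ d → Vec ℤ d → Set
IntersectingRayProperty F m m' =
  ∀ u₁ u₂ u₁' u₂' → u₁ ∈ F → u₂ ∈ F → u₁' ∈ F → u₂' ∈ F →
  Meet F u₁ m u₁' m' → Meet F u₂ m u₂' m' →
  Meet F u₁ m u₂' m' →
  Meet F u₁' m' u₂ m × (∣ray∣ F u₁ m ℕ.* ∣ray∣ F u₂' m' ≡ ∣ray∣ F u₂ m ℕ.* ∣ray∣ F u₁' m')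

-- For the uniform distribution the (x, z) entry of H_m H_m' is
-- 1 / (|R(x,m)| |R(z,m')|) when the ray through x parallel to m meets the ray
-- through z parallel to m', and 0 otherwise: by non-collinearity the two lines
-- meet in at most one point, so the product has at most one nonzero term.
-- Hence the matrices commute iff, for all x, z ∈ F, R(x,m) meets R(z,m') exactly
-- when R(x,m') meets R(z,m), and then |R(x,m)| |R(z,m')| = |R(x,m')| |R(z,m)|.
-- Since a ray is the ray through any of its points, this pointwise condition is
-- the intersecting ray property.
module Submission where

open import Defs
open import Algebra.Bundles using (CommutativeMonoid)
import Algebra.Properties.CommutativeSemigroup as CommutativeSemigroupProperties
import Algebra.Properties.Group as GroupProperties
open import Data.Empty using (⊥-elim)
open import Data.Integer as ℤ using (ℤ; +0)
import Data.Integer.Properties as ℤP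
open import Data.Integer.Tactic.RingSolver using (solve-∀)
open import Data.List as List using (List; []; _∷_; length)
open import Data.List.Membership.Propositional using (_∈_; find; lose)
open import Data.List.Membership.Propositional.Properties using (∈-filter⁺)
open import Data.List.Properties using (filter-≐)
import Data.List.Relation.Unary.All as All
open import Data.List.Relation.Unary.AllPairs using (_∷_)
open import Data.List.Relation.Unary.Any using (Any; here; there; any?)
open import Data.List.Relation.Unary.Unique.Propositional using (Unique)
open import Data.Nat as ℕ using (ℕ; zero; suc)
import Data.Nat.Properties as ℕP
open import Data.Product using (_×_; _,_; proj₁; proj₂)
open import Data.Rational as ℚ using (ℚ; 0ℚ; 1ℚ)
import Data.Rational.Properties as ℚP
open import Data.Vec using (Vec; []; _∷_)
import Data.Vec.Properties as VecP
open import Function using (case_of_; _∘_)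
open import Function.Bundles using (_⇔_; mk⇔)
open import Function.Properties.Equivalence using () renaming (trans to ⇔-trans; sym to ⇔-sym)
open import Relation.Binary.PropositionalEquality
open import Relation.Nullary using (¬_; Dec; yes; no)
open import Relation.Nullary.Decidable using (map′; _×-dec_)

open CommutativeSemigroupProperties (CommutativeMonoid.commutativeSemigroup ℚP.*-1-commutativeMonoid)
  using () renaming (interchange to *-interchange; x∙yz≈y∙xz to *-left-comm)
open GroupProperties ℚP.+-0-group using () renaming (∙-cancelˡ to +-cancelˡ)

-ᵥ-self : ∀ {d} (x m : Vec ℤ d) → x -ᵥ x ≡ +0 ·ᵥ m
-ᵥ-self [] [] = refl
-ᵥ-self (xᵢ ∷ x) (mᵢ ∷ m) = cong₂ _∷_ (trans (ℤP.+-inverseʳ xᵢ) (sym (ℤP.*-zeroˡ mᵢ))) (-ᵥ-self x m)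

-ᵥ-antisym : ∀ {d} k (x y m : Vec ℤ d) → y -ᵥ x ≡ k ·ᵥ m → x -ᵥ y ≡ (ℤ.- k) ·ᵥ m
-ᵥ-antisym k [] [] [] _ = refl
-ᵥ-antisym k (xᵢ ∷ x) (yᵢ ∷ y) (mᵢ ∷ m) e with VecP.∷-injective e
... | eᵢ , e′ = cong₂ _∷_ (begin
  xᵢ ℤ.- yᵢ            ≡⟨ flip xᵢ yᵢ ⟩
  ℤ.- (yᵢ ℤ.- xᵢ)      ≡⟨ cong ℤ.-_ eᵢ ⟩
  ℤ.- (k ℤ.* mᵢ)       ≡⟨ ℤP.neg-distribˡ-* k mᵢ ⟩
  ℤ.- k ℤ.* mᵢ         ∎) (-ᵥ-antisym k x y m e′)
  where
  open ≡-Reasoning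
  flip : ∀ a b → a ℤ.- b ≡ ℤ.- (b ℤ.- a)
  flip = solve-∀

-ᵥ-chain : ∀ {d} j k (x y z m : Vec ℤ d) → y -ᵥ x ≡ j ·ᵥ m → z -ᵥ y ≡ k ·ᵥ m → z -ᵥ x ≡ (j ℤ.+ k) ·ᵥ m
-ᵥ-chain j k [] [] [] [] _ _ = refl
-ᵥ-chain j k (xᵢ ∷ x) (yᵢ ∷ y) (zᵢ ∷ z) (mᵢ ∷ m) e f with VecP.∷-injective e | VecP.∷-injective f
... | eᵢ , e′ | fᵢ , f′ = cong₂ _∷_ (begin
  zᵢ ℤ.- xᵢ                       ≡⟨ split xᵢ yᵢ zᵢ ⟩
  (yᵢ ℤ.- xᵢ) ℤ.+ (zᵢ ℤ.- yᵢ)     ≡⟨ cong₂ ℤ._+_ eᵢ fᵢ ⟩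
  j ℤ.* mᵢ ℤ.+ k ℤ.* mᵢ           ≡⟨ ℤP.*-distribʳ-+ mᵢ j k ⟨
  (j ℤ.+ k) ℤ.* mᵢ                ∎) (-ᵥ-chain j k x y z m e′ f′)
  where
  open ≡-Reasoning
  split : ∀ a b c → c ℤ.- a ≡ (b ℤ.- a) ℤ.+ (c ℤ.- b)
  split = solve-∀

-ᵥ≡0·ᵥ⇒≡ : ∀ {d} (x y m : Vec ℤ d) → y -ᵥ x ≡ +0 ·ᵥ m → y ≡ x
-ᵥ≡0·ᵥ⇒≡ [] [] [] _ = refl
-ᵥ≡0·ᵥ⇒≡ (xᵢ ∷ x) (yᵢ ∷ y) (mᵢ ∷ m) e with VecP.∷-injective e
... | eᵢ , e′ = cong₂ _∷_ (begin
  yᵢ                      ≡⟨ shift xᵢ yᵢ ⟩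
  (yᵢ ℤ.- xᵢ) ℤ.+ xᵢ      ≡⟨ cong (ℤ._+ xᵢ) (trans eᵢ (ℤP.*-zeroˡ mᵢ)) ⟩
  +0 ℤ.+ xᵢ               ≡⟨ ℤP.+-identityˡ xᵢ ⟩
  xᵢ                      ∎) (-ᵥ≡0·ᵥ⇒≡ x y m e′)
  where
  open ≡-Reasoning
  shift : ∀ a b → b ≡ (b ℤ.- a) ℤ.+ a
  shift = solve-∀

·ᵥ-common⇒lin≡0 : ∀ {d} a b (v m m' : Vec ℤ d) → v ≡ a ·ᵥ m → v ≡ b ·ᵥ m' → lin a m (ℤ.- b) m' ≡ zeroᵥ
·ᵥ-common⇒lin≡0 a b [] [] [] _ _ = refl
·ᵥ-common⇒lin≡0 a b (vᵢ ∷ v) (mᵢ ∷ m) (m'ᵢ ∷ m') e f with VecP.∷-injective e | VecP.∷-injective f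
... | eᵢ , e′ | fᵢ , f′ = cong₂ _∷_ (begin
  a ℤ.* mᵢ ℤ.+ ℤ.- b ℤ.* m'ᵢ      ≡⟨ cong (ℤ._+ ℤ.- b ℤ.* m'ᵢ) eᵢ ⟨
  vᵢ ℤ.+ ℤ.- b ℤ.* m'ᵢ            ≡⟨ cong (λ t → vᵢ ℤ.+ t) (ℤP.neg-distribˡ-* b m'ᵢ) ⟨
  vᵢ ℤ.- b ℤ.* m'ᵢ                ≡⟨ cong (λ t → vᵢ ℤ.- t) fᵢ ⟨
  vᵢ ℤ.- vᵢ                       ≡⟨ ℤP.+-inverseʳ vᵢ ⟩
  +0                               ∎) (·ᵥ-common⇒lin≡0 a b v m m' e′ f′)
  where
  open ≡-Reasoning

lin-comm : ∀ {d} a b (m m' : Vec ℤ d) → lin a m b m' ≡ lin b m' a m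
lin-comm a b [] [] = refl
lin-comm a b (mᵢ ∷ m) (m'ᵢ ∷ m') = cong₂ _∷_ (ℤP.+-comm (a ℤ.* mᵢ) (b ℤ.* m'ᵢ)) (lin-comm a b m m')

InLine-refl : ∀ {d} (x m : Vec ℤ d) → InLine x m x
InLine-refl x m = +0 , -ᵥ-self x m

InLine-sym : ∀ {d} {x y m : Vec ℤ d} → InLine x m y → InLine y m x
InLine-sym {x = x} {y} {m} (k , e) = ℤ.- k , -ᵥ-antisym k x y m e

InLine-trans : ∀ {d} {x y z m : Vec ℤ d} → InLine x m y → InLine y m z → InLine x m z
InLine-trans {x = x} {y} {z} {m} (j , e) (k , f) = j ℤ.+ k , -ᵥ-chain j k x y z m e f

NotCollinear-sym : ∀ {d} {m m' : Vec ℤ d} → NotCollinear m m' → NotCollinear m' m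
NotCollinear-sym {m = m} {m'} nc a b e with nc b a (trans (lin-comm b a m m') e)
... | b≡0 , a≡0 = a≡0 , b≡0

-- y - y' is a multiple of both m and m', hence zero.
InLine-meet-unique : ∀ {d} {m m' x z y y' : Vec ℤ d} → NotCollinear m m' →
  InLine x m y → InLine z m' y → InLine x m y' → InLine z m' y' → y ≡ y'
InLine-meet-unique {m = m} {m'} {y = y} {y'} nc xy zy xy' zy'
  with InLine-trans (InLine-sym xy') xy | InLine-trans (InLine-sym zy') zy
... | a , e | b , f with nc a (ℤ.- b) (·ᵥ-common⇒lin≡0 a b (y -ᵥ y') m m' e f)
... | refl , _ = -ᵥ≡0·ᵥ⇒≡ y' y m e

∣ray∣-cong : ∀ {d} (F : List (Vec ℤ d)) {u a m} → InLine u m a → ∣ray∣ F a m ≡ ∣ray∣ F u m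
∣ray∣-cong F {u} {a} {m} ua =
  cong length (filter-≐ (inLine? a m) (inLine? u m) (InLine-trans ua , InLine-trans (InLine-sym ua)) F)

∣ray∣-nonZero : ∀ {d} {F : List (Vec ℤ d)} {x} m → x ∈ F → ℕ.NonZero (∣ray∣ F x m)
∣ray∣-nonZero {x = x} m x∈F = nonEmpty (∈-filter⁺ (inLine? x m) x∈F (InLine-refl x m))
  where
  nonEmpty : ∀ {A : Set} {a : A} {as} → a ∈ as → ℕ.NonZero (length as)
  nonEmpty {as = _ ∷ _} _ = _

*-inv : ∀ p → p ≢ 0ℚ → p ℚ.* inv p ≡ 1ℚ
*-inv p p≢0 with p ℚ.≟ 0ℚ
... | yes p≡0 = ⊥-elim (p≢0 p≡0)
... | no p≢0′ = ℚP.*-inverseʳ p {{ℚ.≢-nonZero p≢0′}}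

inv-unique : ∀ p q → p ℚ.* q ≡ 1ℚ → inv p ≡ q
inv-unique p q pq≡1 = begin
  inv p                    ≡⟨ ℚP.*-identityʳ (inv p) ⟨
  inv p ℚ.* 1ℚ             ≡⟨ cong (inv p ℚ.*_) pq≡1 ⟨
  inv p ℚ.* (p ℚ.* q)      ≡⟨ ℚP.*-assoc (inv p) p q ⟨
  (inv p ℚ.* p) ℚ.* q      ≡⟨ cong (ℚ._* q) (trans (ℚP.*-comm (inv p) p) (*-inv p p≢0)) ⟩
  1ℚ ℚ.* q                 ≡⟨ ℚP.*-identityˡ q ⟩
  q                        ∎
  where
  open ≡-Reasoning
  p≢0 : p ≢ 0ℚ
  p≢0 refl = ℚP.1≢0 (trans (sym pq≡1) (ℚP.*-zeroˡ q))

inv-involutive : ∀ p → inv (inv p) ≡ p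
inv-involutive p = case p ℚ.≟ 0ℚ of λ where
  (yes refl) → refl
  (no p≢0) → inv-unique (inv p) p (trans (ℚP.*-comm (inv p) p) (*-inv p p≢0))

inv-≢0 : ∀ p → p ≢ 0ℚ → inv p ≢ 0ℚ
inv-≢0 p p≢0 inv≡0 = p≢0 (trans (sym (inv-involutive p)) (cong inv inv≡0))

-- No side conditions are needed since inv 0ℚ = 0ℚ.
inv-* : ∀ p q → inv (p ℚ.* q) ≡ inv p ℚ.* inv q
inv-* p q = case ((p ℚ.≟ 0ℚ) , (q ℚ.≟ 0ℚ)) of λ where
  (yes refl , _) → trans (cong inv (ℚP.*-zeroˡ q)) (sym (ℚP.*-zeroˡ (inv q)))
  (_ , yes refl) → trans (cong inv (ℚP.*-zeroʳ p)) (sym (ℚP.*-zeroʳ (inv p)))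
  (no p≢0 , no q≢0) → inv-unique (p ℚ.* q) (inv p ℚ.* inv q)
    (trans (*-interchange p q (inv p) (inv q))
           (trans (cong₂ ℚ._*_ (*-inv p p≢0) (*-inv q q≢0)) (ℚP.*-identityˡ 1ℚ)))

toℚ : ℕ → ℚ
toℚ zero = 0ℚ
toℚ (suc n) = 1ℚ ℚ.+ toℚ n

toℚ-+ : ∀ a b → toℚ (a ℕ.+ b) ≡ toℚ a ℚ.+ toℚ b
toℚ-+ zero b = sym (ℚP.+-identityˡ (toℚ b))
toℚ-+ (suc a) b = trans (cong (1ℚ ℚ.+_) (toℚ-+ a b)) (sym (ℚP.+-assoc 1ℚ (toℚ a) (toℚ b)))

toℚ-* : ∀ a b → toℚ (a ℕ.* b) ≡ toℚ a ℚ.* toℚ b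
toℚ-* zero b = sym (ℚP.*-zeroˡ (toℚ b))
toℚ-* (suc a) b = begin
  toℚ (b ℕ.+ a ℕ.* b)               ≡⟨ toℚ-+ b (a ℕ.* b) ⟩
  toℚ b ℚ.+ toℚ (a ℕ.* b)           ≡⟨ cong₂ ℚ._+_ (sym (ℚP.*-identityˡ (toℚ b))) (toℚ-* a b) ⟩
  1ℚ ℚ.* toℚ b ℚ.+ toℚ a ℚ.* toℚ b  ≡⟨ ℚP.*-distribʳ-+ (toℚ b) 1ℚ (toℚ a) ⟨
  toℚ (suc a) ℚ.* toℚ b             ∎
  where open ≡-Reasoning

toℚ-nonNeg : ∀ n → 0ℚ ℚ.≤ toℚ n
toℚ-nonNeg zero = ℚP.≤-refl
toℚ-nonNeg (suc n) = ℚP.+-mono-≤ (ℚP.<⇒≤ (ℚP.positive⁻¹ 1ℚ)) (toℚ-nonNeg n)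

toℚ-≢0 : ∀ n .{{_ : ℕ.NonZero n}} → toℚ n ≢ 0ℚ
toℚ-≢0 (suc n) = ≢-sym (ℚP.<⇒≢ (ℚP.+-mono-<-≤ (ℚP.positive⁻¹ 1ℚ) (toℚ-nonNeg n)))

toℚ-injective : ∀ {a b} → toℚ a ≡ toℚ b → a ≡ b
toℚ-injective {zero} {zero} _ = refl
toℚ-injective {zero} {suc b} e = ⊥-elim (toℚ-≢0 (suc b) (sym e))
toℚ-injective {suc a} {zero} e = ⊥-elim (toℚ-≢0 (suc a) e)
toℚ-injective {suc a} {suc b} e = cong suc (toℚ-injective (+-cancelˡ 1ℚ (toℚ a) (toℚ b) e))

inv-toℚ-injective : ∀ {a b} → inv (toℚ a) ≡ inv (toℚ b) → a ≡ b
inv-toℚ-injective {a} {b} e =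
  toℚ-injective (trans (sym (inv-involutive (toℚ a))) (trans (cong inv e) (inv-involutive (toℚ b))))

sum-const : ∀ {A : Set} c (xs : List A) → sumℚ (List.map (λ _ → c) xs) ≡ toℚ (length xs) ℚ.* c
sum-const c [] = sym (ℚP.*-zeroˡ c)
sum-const c (_ ∷ xs) = begin
  c ℚ.+ sumℚ (List.map (λ _ → c) xs)   ≡⟨ cong₂ ℚ._+_ (sym (ℚP.*-identityˡ c)) (sum-const c xs) ⟩
  1ℚ ℚ.* c ℚ.+ toℚ (length xs) ℚ.* c   ≡⟨ ℚP.*-distribʳ-+ c 1ℚ (toℚ (length xs)) ⟨
  toℚ (suc (length xs)) ℚ.* c          ∎
  where open ≡-Reasoning

sum-zero : ∀ {A : Set} (f : A → ℚ) xs → (∀ {y} → y ∈ xs → f y ≡ 0ℚ) → sumℚ (List.map f xs) ≡ 0ℚ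
sum-zero f [] _ = refl
sum-zero f (x ∷ xs) f≡0 =
  trans (cong₂ ℚ._+_ (f≡0 (here refl)) (sum-zero f xs (f≡0 ∘ there))) (ℚP.+-identityˡ 0ℚ)

sum-single : ∀ {A : Set} (f : A → ℚ) {xs y} → Unique xs → y ∈ xs →
  (∀ {y'} → y' ∈ xs → y' ≢ y → f y' ≡ 0ℚ) → sumℚ (List.map f xs) ≡ f y
sum-single f {x ∷ xs} (x∉xs ∷ _) (here refl) f≡0 =
  trans (cong (f x ℚ.+_) (sum-zero f xs (λ y∈ → f≡0 (there y∈) (≢-sym (All.lookup x∉xs y∈)))))
        (ℚP.+-identityʳ (f x))
sum-single f {x ∷ xs} (x∉xs ∷ uniq) (there y∈xs) f≡0 =
  trans (cong₂ ℚ._+_ (f≡0 (here refl) (All.lookup x∉xs y∈xs)) (sum-single f uniq y∈xs (f≡0 ∘ there)))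
        (ℚP.+-identityˡ _)

uniform≢0 : ∀ {d} {F : List (Vec ℤ d)} {x} y → x ∈ F → uniform F y ≢ 0ℚ
uniform≢0 {F = _ ∷ F} _ _ = inv-≢0 ∣F∣ (≢-sym (ℚP.<⇒≢ (ℚP.positive⁻¹ ∣F∣ {{ℚP.normalize-pos (suc (length F)) 1}})))
  where
  ∣F∣ : ℚ
  ∣F∣ = ℤ.+ suc (length F) ℚ./ 1

H-offLine : ∀ {d} π F {m x y : Vec ℤ d} → ¬ InLine x m y → H π F m x y ≡ 0ℚ
H-offLine π F {m} {x} {y} ¬xy with inLine? x m y
... | yes xy = ⊥-elim (¬xy xy)
... | no _ = refl

-- w ∈ F only ensures |F| ≠ 0, so that the uniform weight cancels.
H-onLine : ∀ {d} (F : List (Vec ℤ d)) {w m x y} → w ∈ F → InLine x m y →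
  H (uniform F) F m x y ≡ inv (toℚ (∣ray∣ F x m))
H-onLine F {w} {m} {x} {y} w∈F xy with inLine? x m y
... | no ¬xy = ⊥-elim (¬xy xy)
... | yes _ = begin
  c ℚ.* inv (mass (uniform F) (ray F x m))   ≡⟨ cong (λ s → c ℚ.* inv s) (sum-const c (ray F x m)) ⟩
  c ℚ.* inv (toℚ n ℚ.* c)                   ≡⟨ cong (c ℚ.*_) (inv-* (toℚ n) c) ⟩
  c ℚ.* (inv (toℚ n) ℚ.* inv c)             ≡⟨ *-left-comm c (inv (toℚ n)) (inv c) ⟩
  inv (toℚ n) ℚ.* (c ℚ.* inv c)             ≡⟨ cong (inv (toℚ n) ℚ.*_) (*-inv c (uniform≢0 y w∈F)) ⟩
  inv (toℚ n) ℚ.* 1ℚ                        ≡⟨ ℚP.*-identityʳ (inv (toℚ n)) ⟩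
  inv (toℚ n)                               ∎
  where
  open ≡-Reasoning
  c : ℚ
  c = uniform F y
  n : ℕ
  n = ∣ray∣ F x m

module _ {d} (F : List (Vec ℤ d)) (m m' : Vec ℤ d) where

  meet? : ∀ x z → Dec (Meet F x m z m')
  meet? x z = map′ fromAny toAny (any? (λ y → inLine? x m y ×-dec inLine? z m' y) F)
    where
    OnBoth : Vec ℤ d → Set
    OnBoth y = InLine x m y × InLine z m' y
    fromAny : Any OnBoth F → Meet F x m z m'
    fromAny a with find a
    ... | y , y∈F , xy , zy = y , (y∈F , xy) , (y∈F , zy)
    toAny : Meet F x m z m' → Any OnBoth F
    toAny (y , (y∈F , xy) , (_ , zy)) = lose y∈F (xy , zy)

  term-vanishes : ∀ π {x y z} → ¬ (InLine x m y × InLine y m' z) → H π F m x y ℚ.* H π F m' y z ≡ 0ℚ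
  term-vanishes π {x} {y} {z} ¬xyz = case inLine? x m y of λ where
    (no ¬xy) → trans (cong (ℚ._* H π F m' y z) (H-offLine π F ¬xy)) (ℚP.*-zeroˡ (H π F m' y z))
    (yes xy) → trans (cong (H π F m x y ℚ.*_) (H-offLine π F (λ yz → ¬xyz (xy , yz)))) (ℚP.*-zeroʳ (H π F m x y))

  mul-H-disjoint : ∀ π {x z} → ¬ Meet F x m z m' → mul F (H π F m) (H π F m') x z ≡ 0ℚ
  mul-H-disjoint π ¬meet =
    sum-zero _ F (λ y∈F → term-vanishes π (λ (xy , yz) → ¬meet (_ , (y∈F , xy) , (y∈F , InLine-sym yz))))

  mul-H-meet : NotCollinear m m' → Unique F → ∀ {x z} → Meet F x m z m' →
    mul F (H (uniform F) F m) (H (uniform F) F m') x z ≡ inv (toℚ (∣ray∣ F x m ℕ.* ∣ray∣ F z m'))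
  mul-H-meet nc uniq {x} {z} (y₀ , (y₀∈F , xy₀) , (_ , zy₀)) = begin
    mul F (H π F m) (H π F m') x z                   ≡⟨ sum-single _ uniq y₀∈F off-y₀ ⟩
    H π F m x y₀ ℚ.* H π F m' y₀ z                   ≡⟨ cong₂ ℚ._*_ (H-onLine F y₀∈F xy₀) (H-onLine F y₀∈F (InLine-sym zy₀)) ⟩
    inv (toℚ a) ℚ.* inv (toℚ (∣ray∣ F y₀ m'))        ≡⟨ cong (λ n → inv (toℚ a) ℚ.* inv (toℚ n)) (∣ray∣-cong F zy₀) ⟩
    inv (toℚ a) ℚ.* inv (toℚ b)                      ≡⟨ inv-* (toℚ a) (toℚ b) ⟨
    inv (toℚ a ℚ.* toℚ b)                            ≡⟨ cong inv (toℚ-* a b) ⟨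
    inv (toℚ (a ℕ.* b))                              ∎
    where
    open ≡-Reasoning
    π : Vec ℤ d → ℚ
    π = uniform F
    a : ℕ
    a = ∣ray∣ F x m
    b : ℕ
    b = ∣ray∣ F z m'
    off-y₀ : ∀ {y} → y ∈ F → y ≢ y₀ → H π F m x y ℚ.* H π F m' y z ≡ 0ℚ
    off-y₀ _ y≢y₀ = term-vanishes π (λ (xy , yz) → y≢y₀ (InLine-meet-unique nc xy (InLine-sym yz) xy₀ zy₀))

Meet-self : ∀ {d} {F : List (Vec ℤ d)} {x} m m' → x ∈ F → Meet F x m x m'
Meet-self {x = x} m m' x∈F = x , (x∈F , InLine-refl x m) , (x∈F , InLine-refl x m')

Meet-swap : ∀ {d} {F : List (Vec ℤ d)} {x m z m'} → Meet F x m z m' → Meet F z m' x m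
Meet-swap (y , xy , zy) = y , zy , xy

Meet-transport : ∀ {d} {F : List (Vec ℤ d)} {u m u' m' a a'} → InLine u m a → InLine u' m' a' →
  Meet F u m u' m' → Meet F a m a' m'
Meet-transport ua u'a' (y , (y∈F , uy) , (_ , u'y)) =
  y , (y∈F , InLine-trans (InLine-sym ua) uy) , (y∈F , InLine-trans (InLine-sym u'a') u'y)

-- R₁, R₁' are the rays through x and R₂, R₂' those through z
PointwiseIntersectingRayProperty : ∀ {d} → List (Vec ℤ d) → Vec ℤ d → Vec ℤ d → Set
PointwiseIntersectingRayProperty F m m' = ∀ x z → x ∈ F → z ∈ F →
  Meet F x m z m' → Meet F x m' z m × (∣ray∣ F x m ℕ.* ∣ray∣ F z m' ≡ ∣ray∣ F z m ℕ.* ∣ray∣ F x m')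

irp⇔pointwise : ∀ {d} (F : List (Vec ℤ d)) m m' →
  IntersectingRayProperty F m m' ⇔ PointwiseIntersectingRayProperty F m m'
irp⇔pointwise F m m' = mk⇔ specialise generalise
  where
  specialise : IntersectingRayProperty F m m' → PointwiseIntersectingRayProperty F m m'
  specialise irp x z x∈F z∈F = irp x z x z x∈F z∈F x∈F z∈F (Meet-self m m' x∈F) (Meet-self m m' z∈F)

  generalise : PointwiseIntersectingRayProperty F m m' → IntersectingRayProperty F m m'
  generalise pirp u₁ u₂ u₁' u₂' _ _ _ _ (a , (a∈F , u₁a) , (_ , u₁'a)) (b , (b∈F , u₂b) , (_ , u₂'b)) R₁R₂'
    with pirp a b a∈F b∈F (Meet-transport u₁a u₂'b R₁R₂')
  ... | meet , sizes = Meet-transport (InLine-sym u₁'a) (InLine-sym u₂b) meet , (begin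
    ∣ray∣ F u₁ m ℕ.* ∣ray∣ F u₂' m'   ≡⟨ cong₂ ℕ._*_ (∣ray∣-cong F u₁a) (∣ray∣-cong F u₂'b) ⟨
    ∣ray∣ F a m ℕ.* ∣ray∣ F b m'      ≡⟨ sizes ⟩
    ∣ray∣ F b m ℕ.* ∣ray∣ F a m'      ≡⟨ cong₂ ℕ._*_ (∣ray∣-cong F u₂b) (∣ray∣-cong F u₁'a) ⟩
    ∣ray∣ F u₂ m ℕ.* ∣ray∣ F u₁' m'   ∎)
    where open ≡-Reasoning

commute⇔pointwise : ∀ {d} (F : List (Vec ℤ d)) m m' → NotCollinear m m' → Unique F →
  Commute F (H (uniform F) F m) (H (uniform F) F m') ⇔ PointwiseIntersectingRayProperty F m m'
commute⇔pointwise {d} F m m' nc uniq = mk⇔ pointwise commute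
  where
  π : Vec ℤ d → ℚ
  π = uniform F

  swapped-product : Commute F (H π F m) (H π F m') → ∀ {x z} → x ∈ F → z ∈ F → Meet F x m z m' →
    mul F (H π F m') (H π F m) x z ≡ inv (toℚ (∣ray∣ F x m ℕ.* ∣ray∣ F z m'))
  swapped-product comm x∈F z∈F meet = trans (sym (comm _ _ x∈F z∈F)) (mul-H-meet F m m' nc uniq meet)

  pointwise : Commute F (H π F m) (H π F m') → PointwiseIntersectingRayProperty F m m'
  pointwise comm x z x∈F z∈F meet with meet? F m' m x z
  ... | yes meet' = meet' , trans sizes (ℕP.*-comm (∣ray∣ F x m') (∣ray∣ F z m))
    where
    sizes : ∣ray∣ F x m ℕ.* ∣ray∣ F z m' ≡ ∣ray∣ F x m' ℕ.* ∣ray∣ F z m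
    sizes = inv-toℚ-injective (trans (sym (swapped-product comm x∈F z∈F meet))
                                     (mul-H-meet F m' m (NotCollinear-sym nc) uniq meet'))
  ... | no ¬meet' = ⊥-elim (inv-≢0 _ (toℚ-≢0 _ {{nonZero}})
                              (trans (sym (swapped-product comm x∈F z∈F meet)) (mul-H-disjoint F m' m π ¬meet')))
    where
    nonZero : ℕ.NonZero (∣ray∣ F x m ℕ.* ∣ray∣ F z m')
    nonZero = ℕP.m*n≢0 _ _ {{∣ray∣-nonZero m x∈F}} {{∣ray∣-nonZero m' z∈F}}

  commute : PointwiseIntersectingRayProperty F m m' → Commute F (H π F m) (H π F m')
  commute pirp x z x∈F z∈F with meet? F m m' x z | meet? F m' m x z
  ... | yes meet | yes meet' = begin
    mul F (H π F m) (H π F m') x z             ≡⟨ mul-H-meet F m m' nc uniq meet ⟩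
    inv (toℚ (∣ray∣ F x m ℕ.* ∣ray∣ F z m'))   ≡⟨ cong (inv ∘ toℚ) sizes ⟩
    inv (toℚ (∣ray∣ F x m' ℕ.* ∣ray∣ F z m))   ≡⟨ mul-H-meet F m' m (NotCollinear-sym nc) uniq meet' ⟨
    mul F (H π F m') (H π F m) x z             ∎
    where
    open ≡-Reasoning
    sizes : ∣ray∣ F x m ℕ.* ∣ray∣ F z m' ≡ ∣ray∣ F x m' ℕ.* ∣ray∣ F z m
    sizes = trans (proj₂ (pirp x z x∈F z∈F meet)) (ℕP.*-comm (∣ray∣ F z m) (∣ray∣ F x m'))
  ... | yes meet | no ¬meet' = ⊥-elim (¬meet' (proj₁ (pirp x z x∈F z∈F meet)))
  ... | no ¬meet | yes meet' = ⊥-elim (¬meet (Meet-swap (proj₁ (pirp z x z∈F x∈F (Meet-swap meet')))))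
  ... | no ¬meet | no ¬meet' = trans (mul-H-disjoint F m m' π ¬meet) (sym (mul-H-disjoint F m' m π ¬meet'))

proposition4p15 : ∀ (d : ℕ) (m m' : Vec ℤ d) (F : List (Vec ℤ d)) →
    NotCollinear m m' → Unique F →
    Commute F (H (uniform F) F m) (H (uniform F) F m') ⇔ IntersectingRayProperty F m m'
proposition4p15 d m m' F nc uniq =
  ⇔-trans (commute⇔pointwise F m m' nc uniq) (⇔-sym (irp⇔pointwise F m m'))
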